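{- Let $K$ be a variety of Boolean algebras with operators having finitely many extra-Boolean operations, with $K=V(\mathrm{Fin}(K))$. Suppose $\mathfrak{A}\in K$ is $K$-freely generated by a finite set $X$, and $\mathfrak{A}$ is generated by a set $Y$ with $|Y|=|X|$. Then $\mathfrak{A}$ is $K$-freely generated by $Y$.
   Context: $\mathrm{Fin}(K)$ is the class of finite members of $K$ and $V(\mathrm{Fin}(K))$ the variety they generate. -}

module Defs where

open import Level using (Level; _⊔_; suc; Lift)
open import Data.Nat using (ℕ)
open import Data.Fin using (Fin)
open import Data.Product using (Σ; ∃; _×_; _,_; proj₁; proj₂)
open import Data.Vec.Functional using (updateAt)
open import Function using (const)
open import Relation.Binary.PropositionalEquality using (_≡_)
open import Relation.Unary using (Pred)
open import Algebra.Lattice.Bundles using (BooleanAlgebra)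

record BAO {m : ℕ} (ar : Fin m → ℕ) (c ℓ : Level) : Set (suc (c ⊔ ℓ)) where
  field
    ba : BooleanAlgebra c ℓ
  open BooleanAlgebra ba public
  field
    op       : (i : Fin m) → (Fin (ar i) → Carrier) → Carrier
    op-cong  : ∀ i {u v : Fin (ar i) → Carrier} → (∀ k → u k ≈ v k) → op i u ≈ op i v
    op-normal   : ∀ i (v : Fin (ar i) → Carrier) (j : Fin (ar i)) →
                  op i (updateAt v j (const ⊥)) ≈ ⊥
    op-additive : ∀ i (v : Fin (ar i) → Carrier) (j : Fin (ar i)) (a b : Carrier) →
                  op i (updateAt v j (const (a ∨ b)))
                    ≈ (op i (updateAt v j (const a)) ∨ op i (updateAt v j (const b)))

data Term {m : ℕ} (ar : Fin m → ℕ) (V : Set) : Set where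
  var   : V → Term ar V
  ⊥t ⊤t : Term ar V
  ¬t    : Term ar V → Term ar V
  _∨t_ _∧t_ : Term ar V → Term ar V → Term ar V
  opt   : (i : Fin m) → (Fin (ar i) → Term ar V) → Term ar V

module _ {m : ℕ} {ar : Fin m → ℕ} {c ℓ : Level} (A : BAO ar c ℓ) where
  open BAO A

  ⟦_⟧ : {V : Set} → Term ar V → (V → Carrier) → Carrier
  ⟦ var x ⟧   ρ = ρ x
  ⟦ ⊥t ⟧      ρ = ⊥
  ⟦ ⊤t ⟧      ρ = ⊤
  ⟦ ¬t t ⟧    ρ = ¬ ⟦ t ⟧ ρ
  ⟦ s ∨t t ⟧  ρ = ⟦ s ⟧ ρ ∨ ⟦ t ⟧ ρ
  ⟦ s ∧t t ⟧  ρ = ⟦ s ⟧ ρ ∧ ⟦ t ⟧ ρ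
  ⟦ opt i ts ⟧ ρ = op i (λ k → ⟦ ts k ⟧ ρ)

Eqn : {m : ℕ} → (Fin m → ℕ) → Set
Eqn ar = Term ar ℕ × Term ar ℕ

_⊨_ : {m : ℕ} {ar : Fin m → ℕ} {c ℓ : Level} → BAO ar c ℓ → Eqn ar → Set (c ⊔ ℓ)
A ⊨ (s , t) = ∀ (ρ : ℕ → BAO.Carrier A) → BAO._≈_ A (⟦ A ⟧ s ρ) (⟦ A ⟧ t ρ)

Class : {m : ℕ} → (Fin m → ℕ) → (c ℓ e : Level) → Set (suc (c ⊔ ℓ ⊔ e))
Class ar c ℓ e = Pred (BAO ar c ℓ) e

Mod : {m : ℕ} {ar : Fin m → ℕ} {e : Level} (c ℓ : Level) → Pred (Eqn ar) e → Class ar c ℓ (c ⊔ ℓ ⊔ e)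
Mod c ℓ E A = ∀ eq → E eq → A ⊨ eq

Th : {m : ℕ} {ar : Fin m → ℕ} {c ℓ e : Level} → Class ar c ℓ e → Pred (Eqn ar) (suc (c ⊔ ℓ) ⊔ e)
Th C eq = ∀ A → C A → A ⊨ eq

-- V(C): the variety generated by C, i.e. Mod(Th(C)) (Birkhoff: = HSP(C)).
V : {m : ℕ} {ar : Fin m → ℕ} {c ℓ e : Level} → Class ar c ℓ e → Class ar c ℓ (suc (c ⊔ ℓ) ⊔ e)
V {c = c} {ℓ} C = Mod c ℓ (Th C)

IsFinite : {m : ℕ} {ar : Fin m → ℕ} {c ℓ : Level} → BAO ar c ℓ → Set (c ⊔ ℓ)
IsFinite A = Σ ℕ λ n → Σ (Fin n → BAO.Carrier A) λ f →
               ∀ a → Σ (Fin n) λ k → BAO._≈_ A (f k) a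

FinPart : {m : ℕ} {ar : Fin m → ℕ} {c ℓ e : Level} → Class ar c ℓ e → Class ar c ℓ (c ⊔ ℓ ⊔ e)
FinPart K A = K A × IsFinite A

_≐_ : {m : ℕ} {ar : Fin m → ℕ} {c ℓ e e' : Level} → Class ar c ℓ e → Class ar c ℓ e' → Set (suc (c ⊔ ℓ) ⊔ e ⊔ e')
K ≐ L = ∀ A → (K A → L A) × (L A → K A)

record IsHom {m : ℕ} {ar : Fin m → ℕ} {c ℓ c' ℓ' : Level}
             (A : BAO ar c ℓ) (B : BAO ar c' ℓ')
             (h : BAO.Carrier A → BAO.Carrier B) : Set (c ⊔ ℓ ⊔ ℓ') where
  private
    module A = BAO A
    module B = BAO B
  field
    cong : ∀ {a b} → a A.≈ b → h a B.≈ h b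
    ⊥-hom : h A.⊥ B.≈ B.⊥
    ⊤-hom : h A.⊤ B.≈ B.⊤
    ¬-hom : ∀ a → h (A.¬ a) B.≈ (B.¬ h a)
    ∨-hom : ∀ a b → h (a A.∨ b) B.≈ (h a B.∨ h b)
    ∧-hom : ∀ a b → h (a A.∧ b) B.≈ (h a B.∧ h b)
    op-hom : ∀ i (v : Fin (ar i) → A.Carrier) → h (A.op i v) B.≈ B.op i (λ k → h (v k))

IsSubuniverse : {m : ℕ} {ar : Fin m → ℕ} {c ℓ : Level} (A : BAO ar c ℓ) →
                Pred (BAO.Carrier A) (c ⊔ ℓ) → Set (c ⊔ ℓ)
IsSubuniverse {ar = ar} A S =
  (∀ {a b} → a ≈ b → S a → S b) ×
  S ⊥ × S ⊤ × (∀ {a} → S a → S (¬ a)) ×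
  (∀ {a b} → S a → S b → S (a ∨ b)) × (∀ {a b} → S a → S b → S (a ∧ b)) ×
  (∀ i (v : Fin (ar i) → Carrier) → (∀ k → S (v k)) → S (op i v))
  where open BAO A

Generates : {m : ℕ} {ar : Fin m → ℕ} {c ℓ : Level} (A : BAO ar c ℓ) {n : ℕ} →
            (Fin n → BAO.Carrier A) → Set (suc (c ⊔ ℓ))
Generates A y = ∀ S → IsSubuniverse A S → (∀ k → S (y k)) → ∀ a → S a

-- Injectivity of an indexing map (so that it enumerates an n-element set).
InjectiveOn : {m : ℕ} {ar : Fin m → ℕ} {c ℓ : Level} (A : BAO ar c ℓ) {n : ℕ} →
              (Fin n → BAO.Carrier A) → Set ℓ
InjectiveOn A {n} y = ∀ {k l : Fin n} → BAO._≈_ A (y k) (y l) → k ≡ l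

FreelyGenerates : {m : ℕ} {ar : Fin m → ℕ} {c ℓ e : Level} → Class ar c ℓ e →
                  (A : BAO ar c ℓ) {n : ℕ} → (Fin n → BAO.Carrier A) → Set (suc (c ⊔ ℓ) ⊔ e)
FreelyGenerates K A {n} y =
  Generates A y ×
  (∀ (B : BAO _ _ _) → K B → (g : Fin n → BAO.Carrier B) →
     Σ (BAO.Carrier A → BAO.Carrier B) λ h →
       IsHom A B h × (∀ k → BAO._≈_ B (h (y k)) (g k)))

module Submission where

-- Let h be the endomorphism of A sending x to y. It is onto since y generates A,
-- so it suffices to show that h is one-to-one: then h is an automorphism carrying
-- x to y, and freeness transfers along it. Fix a finite B ∈ K. A hom A → B is
-- determined by its values on x, so there are finitely many of them, and among
-- φ, φ ∘ h, φ ∘ h², … two coincide: φ ∘ hⁱ ≈ φ ∘ hⁱ⁺ᵒ⁺¹. As hⁱ is onto, φ ≈ (φ ∘ hᵒ) ∘ h,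
-- so φ identifies whatever h identifies. Finally A ∈ V(Fin K) and A is free on x,
-- so two elements of A identified by every hom into a finite member of K are equal.

open import Defs
open import Level using (Level; Lift; lift; lower)
open import Data.Nat using (ℕ; zero; suc; _+_; _^_)
open import Data.Nat.Properties using (n<1+n; m≤n⇒∃[o]m+o≡n; +-suc)
open import Data.Nat.GeneralisedArithmetic using (iterate)
open import Data.Fin using (Fin; zero; suc; toℕ; funToFin; finToFun)
open import Data.Fin.Properties using (pigeonhole; finToFun-funToFin)
open import Data.Product using (Σ; _,_; proj₁; proj₂)
open import Function using (_∘_)
open import Relation.Binary.PropositionalEquality as ≡ using (_≡_)
open import Relation.Unary using (Pred)
import Relation.Binary.Reasoning.Setoid as SetoidReasoning

private
  variable
    c ℓ c′ ℓ′ c″ ℓ″ e : Level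
    m n : ℕ
    ar : Fin m → ℕ

rename : {V W : Set} → (V → W) → Term ar V → Term ar W
rename f (var v)    = var (f v)
rename f ⊥t         = ⊥t
rename f ⊤t         = ⊤t
rename f (¬t t)     = ¬t (rename f t)
rename f (s ∨t t)   = rename f s ∨t rename f t
rename f (s ∧t t)   = rename f s ∧t rename f t
rename f (opt i ts) = opt i (λ k → rename f (ts k))

finEqn : Term ar (Fin n) → Term ar (Fin n) → Eqn ar
finEqn s t = rename toℕ s , rename toℕ t

extendValuation : {C : Set c} → (Fin n → C) → C → ℕ → C
extendValuation {n = zero}  ρ d _       = d
extendValuation {n = suc n} ρ d zero    = ρ zero
extendValuation {n = suc n} ρ d (suc i) = extendValuation (ρ ∘ suc) d i

extendValuation-toℕ : {C : Set c} (ρ : Fin n → C) (d : C) (k : Fin n) →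
                      extendValuation ρ d (toℕ k) ≡ ρ k
extendValuation-toℕ ρ d zero    = ≡.refl
extendValuation-toℕ ρ d (suc k) = extendValuation-toℕ (ρ ∘ suc) d k

iterate-+ : {C : Set c} (f : C → C) (a : C) (i j : ℕ) →
            iterate f a (i + j) ≡ iterate f (iterate f a i) j
iterate-+ f a zero    j = ≡.refl
iterate-+ f a (suc i) j = iterate-+ f (f a) i j

module _ (A : BAO ar c ℓ) where
  open BAO A

  ⟦⟧-cong : {V : Set} (t : Term ar V) {ρ σ : V → Carrier} →
            (∀ v → ρ v ≈ σ v) → ⟦ A ⟧ t ρ ≈ ⟦ A ⟧ t σ
  ⟦⟧-cong (var v)    ρ≈σ = ρ≈σ v
  ⟦⟧-cong ⊥t         ρ≈σ = refl
  ⟦⟧-cong ⊤t         ρ≈σ = refl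
  ⟦⟧-cong (¬t t)     ρ≈σ = ¬-cong (⟦⟧-cong t ρ≈σ)
  ⟦⟧-cong (s ∨t t)   ρ≈σ = ∨-cong (⟦⟧-cong s ρ≈σ) (⟦⟧-cong t ρ≈σ)
  ⟦⟧-cong (s ∧t t)   ρ≈σ = ∧-cong (⟦⟧-cong s ρ≈σ) (⟦⟧-cong t ρ≈σ)
  ⟦⟧-cong (opt i ts) ρ≈σ = op-cong i (λ k → ⟦⟧-cong (ts k) ρ≈σ)

  ⟦⟧-rename : {V W : Set} (f : V → W) (t : Term ar V) (ρ : W → Carrier) →
              ⟦ A ⟧ (rename f t) ρ ≈ ⟦ A ⟧ t (ρ ∘ f)
  ⟦⟧-rename f (var v)    ρ = refl
  ⟦⟧-rename f ⊥t         ρ = refl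
  ⟦⟧-rename f ⊤t         ρ = refl
  ⟦⟧-rename f (¬t t)     ρ = ¬-cong (⟦⟧-rename f t ρ)
  ⟦⟧-rename f (s ∨t t)   ρ = ∨-cong (⟦⟧-rename f s ρ) (⟦⟧-rename f t ρ)
  ⟦⟧-rename f (s ∧t t)   ρ = ∧-cong (⟦⟧-rename f s ρ) (⟦⟧-rename f t ρ)
  ⟦⟧-rename f (opt i ts) ρ = op-cong i (λ k → ⟦⟧-rename f (ts k) ρ)

  ⊨-finEqn : (s t : Term ar (Fin n)) →
             (∀ ρ → ⟦ A ⟧ s ρ ≈ ⟦ A ⟧ t ρ) → A ⊨ finEqn s t
  ⊨-finEqn s t s≈t σ =
    trans (⟦⟧-rename toℕ s σ) (trans (s≈t (σ ∘ toℕ)) (sym (⟦⟧-rename toℕ t σ)))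

  finEqn-⊨ : (s t : Term ar (Fin n)) → A ⊨ finEqn s t → ∀ ρ → ⟦ A ⟧ s ρ ≈ ⟦ A ⟧ t ρ
  finEqn-⊨ s t A⊨s≈t ρ = trans (sym (from-ρ′ s)) (trans (A⊨s≈t ρ′) (from-ρ′ t))
    where
    ρ′ = extendValuation ρ ⊥
    from-ρ′ : ∀ u → ⟦ A ⟧ (rename toℕ u) ρ′ ≈ ⟦ A ⟧ u ρ
    from-ρ′ u = trans (⟦⟧-rename toℕ u ρ′)
                      (⟦⟧-cong u (λ k → reflexive (extendValuation-toℕ ρ ⊥ k)))

  generated-⟦⟧ : (x : Fin n → Carrier) → Generates A x →
                 ∀ a → Σ (Term ar (Fin n)) λ t → ⟦ A ⟧ t x ≈ a
  generated-⟦⟧ {n} x genX a = lower (genX IsValue isSubuniverse (λ k → lift (var k , refl)) a)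
    where
    IsValue : Carrier → Set (c Level.⊔ ℓ)
    IsValue a = Lift c (Σ (Term ar (Fin n)) λ t → ⟦ A ⟧ t x ≈ a)
    isSubuniverse : IsSubuniverse A IsValue
    isSubuniverse =
        (λ { a≈b (lift (t , p)) → lift (t , trans p a≈b) })
      , lift (⊥t , refl) , lift (⊤t , refl)
      , (λ { (lift (t , p)) → lift (¬t t , ¬-cong p) })
      , (λ { (lift (s , p)) (lift (t , q)) → lift (s ∨t t , ∨-cong p q) })
      , (λ { (lift (s , p)) (lift (t , q)) → lift (s ∧t t , ∧-cong p q) })
      , (λ i v ps → lift (opt i (λ k → proj₁ (lower (ps k))) ,
                          op-cong i (λ k → proj₂ (lower (ps k)))))

module _ {A : BAO ar c ℓ} {B : BAO ar c′ ℓ′} where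
  private
    module A = BAO A
    module B = BAO B
  open IsHom

  ⟦⟧-hom : ∀ {φ} → IsHom A B φ → {V : Set} (t : Term ar V) (ρ : V → A.Carrier) →
           φ (⟦ A ⟧ t ρ) B.≈ ⟦ B ⟧ t (φ ∘ ρ)
  ⟦⟧-hom φH (var v)    ρ = B.refl
  ⟦⟧-hom φH ⊥t         ρ = ⊥-hom φH
  ⟦⟧-hom φH ⊤t         ρ = ⊤-hom φH
  ⟦⟧-hom φH (¬t t)     ρ = B.trans (¬-hom φH _) (B.¬-cong (⟦⟧-hom φH t ρ))
  ⟦⟧-hom φH (s ∨t t)   ρ = B.trans (∨-hom φH _ _) (B.∨-cong (⟦⟧-hom φH s ρ) (⟦⟧-hom φH t ρ))
  ⟦⟧-hom φH (s ∧t t)   ρ = B.trans (∧-hom φH _ _) (B.∧-cong (⟦⟧-hom φH s ρ) (⟦⟧-hom φH t ρ))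
  ⟦⟧-hom φH (opt i ts) ρ = B.trans (op-hom φH i _) (B.op-cong i (λ k → ⟦⟧-hom φH (ts k) ρ))

  hom-unique : (x : Fin n → A.Carrier) → Generates A x → ∀ {φ ψ} →
               IsHom A B φ → IsHom A B ψ → (∀ k → φ (x k) B.≈ ψ (x k)) →
               ∀ a → φ a B.≈ ψ a
  hom-unique x genX {φ} {ψ} φH ψH φx≈ψx a = begin
    φ a               ≈⟨ cong φH (A.sym ta) ⟩
    φ (⟦ A ⟧ t x)     ≈⟨ ⟦⟧-hom φH t x ⟩
    ⟦ B ⟧ t (φ ∘ x)   ≈⟨ ⟦⟧-cong B t φx≈ψx ⟩
    ⟦ B ⟧ t (ψ ∘ x)   ≈⟨ ⟦⟧-hom ψH t x ⟨
    ψ (⟦ A ⟧ t x)     ≈⟨ cong ψH ta ⟩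
    ψ a               ∎
    where
    open SetoidReasoning B.setoid
    t = proj₁ (generated-⟦⟧ A x genX a)
    ta = proj₂ (generated-⟦⟧ A x genX a)

  hom-surjective : (y : Fin n → B.Carrier) → Generates B y → ∀ {h} → IsHom A B h →
                   (∀ k → Σ A.Carrier λ a → h a B.≈ y k) →
                   ∀ b → Σ A.Carrier λ a → h a B.≈ b
  hom-surjective y genY {h} hH preimage b =
    ⟦ A ⟧ t (proj₁ ∘ preimage) ,
    B.trans (⟦⟧-hom hH t _) (B.trans (⟦⟧-cong B t (proj₂ ∘ preimage)) tb)
    where
    t = proj₁ (generated-⟦⟧ B y genY b)
    tb = proj₂ (generated-⟦⟧ B y genY b)

  inverse-isHom : ∀ {h} → IsHom A B h → (∀ {a b} → h a B.≈ h b → a A.≈ b) →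
                  (g : B.Carrier → A.Carrier) → (∀ b → h (g b) B.≈ b) → IsHom B A g
  inverse-isHom {h} hH h-injective g hg = record
    { cong   = λ {a} {b} a≈b → h-injective (B.trans (hg a) (B.trans a≈b (B.sym (hg b))))
    ; ⊥-hom  = h-injective (B.trans (hg _) (B.sym (⊥-hom hH)))
    ; ⊤-hom  = h-injective (B.trans (hg _) (B.sym (⊤-hom hH)))
    ; ¬-hom  = λ a → h-injective
        (B.trans (hg _) (B.trans (B.¬-cong (B.sym (hg a))) (B.sym (¬-hom hH _))))
    ; ∨-hom  = λ a b → h-injective
        (B.trans (hg _) (B.trans (B.∨-cong (B.sym (hg a)) (B.sym (hg b))) (B.sym (∨-hom hH _ _))))
    ; ∧-hom  = λ a b → h-injective
        (B.trans (hg _) (B.trans (B.∧-cong (B.sym (hg a)) (B.sym (hg b))) (B.sym (∧-hom hH _ _))))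
    ; op-hom = λ i v → h-injective
        (B.trans (hg _) (B.trans (B.op-cong i (λ k → B.sym (hg (v k)))) (B.sym (op-hom hH i _))))
    }

∘-isHom : {A : BAO ar c ℓ} {B : BAO ar c′ ℓ′} {C : BAO ar c″ ℓ″} → ∀ {φ ψ} →
          IsHom A B φ → IsHom B C ψ → IsHom A C (ψ ∘ φ)
∘-isHom {C = C} φH ψH = record
  { cong   = λ a≈b → cong ψH (cong φH a≈b)
  ; ⊥-hom  = C.trans (cong ψH (⊥-hom φH)) (⊥-hom ψH)
  ; ⊤-hom  = C.trans (cong ψH (⊤-hom φH)) (⊤-hom ψH)
  ; ¬-hom  = λ a → C.trans (cong ψH (¬-hom φH a)) (¬-hom ψH _)
  ; ∨-hom  = λ a b → C.trans (cong ψH (∨-hom φH a b)) (∨-hom ψH _ _)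
  ; ∧-hom  = λ a b → C.trans (cong ψH (∧-hom φH a b)) (∧-hom ψH _ _)
  ; op-hom = λ i v → C.trans (cong ψH (op-hom φH i v)) (op-hom ψH i _)
  }
  where
  module C = BAO C
  open IsHom

module _ {A : BAO ar c ℓ} {h : BAO.Carrier A → BAO.Carrier A} (hH : IsHom A A h) where
  open BAO A

  iterate-isHom : ∀ i → IsHom A A (λ a → iterate h a i)
  iterate-isHom zero    = record
    { cong = λ a≈b → a≈b ; ⊥-hom = refl ; ⊤-hom = refl
    ; ¬-hom = λ _ → refl ; ∨-hom = λ _ _ → refl ; ∧-hom = λ _ _ → refl
    ; op-hom = λ _ _ → refl }
  iterate-isHom (suc i) = ∘-isHom hH (iterate-isHom i)

  iterate-surjective : (∀ a → Σ Carrier λ a′ → h a′ ≈ a) →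
                       ∀ i a → Σ Carrier λ a′ → iterate h a′ i ≈ a
  iterate-surjective h-surjective zero    a = a , refl
  iterate-surjective h-surjective (suc i) a =
    let (a₁ , p₁) = iterate-surjective h-surjective i a
        (a₂ , p₂) = h-surjective a₁
    in a₂ , trans (IsHom.cong (iterate-isHom i) p₂) p₁

module _ {A : BAO ar c ℓ} {B : BAO ar c′ ℓ′}
         (x : Fin n → BAO.Carrier A) (genX : Generates A x) (finB : IsFinite B) where
  private
    module B = BAO B
    N = proj₁ finB
    enum = proj₁ (proj₂ finB)
    index : B.Carrier → Fin N
    index b = proj₁ (proj₂ (proj₂ finB) b)
    enum-index : ∀ b → enum (index b) B.≈ b
    enum-index b = proj₂ (proj₂ (proj₂ finB) b)

  homCode : (BAO.Carrier A → B.Carrier) → Fin (N ^ n)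
  homCode φ = funToFin (λ k → index (φ (x k)))

  homCode-injective : ∀ {φ ψ} → IsHom A B φ → IsHom A B ψ →
                      homCode φ ≡ homCode ψ → ∀ a → φ a B.≈ ψ a
  homCode-injective {φ} {ψ} φH ψH codes≡ = hom-unique x genX φH ψH λ k → begin
    φ (x k)                 ≈⟨ enum-index (φ (x k)) ⟨
    enum (index (φ (x k)))  ≡⟨ ≡.cong enum (index-on-x k) ⟩
    enum (index (ψ (x k)))  ≈⟨ enum-index (ψ (x k)) ⟩
    ψ (x k)                 ∎
    where
    open SetoidReasoning B.setoid
    index-on-x : ∀ k → index (φ (x k)) ≡ index (ψ (x k))
    index-on-x k = ≡.trans (≡.sym (finToFun-funToFin _ k))
                           (≡.trans (≡.cong (λ z → finToFun z k) codes≡)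
                                    (finToFun-funToFin _ k))

  hom-sequence-repeats : (φ : ℕ → BAO.Carrier A → B.Carrier) → (∀ i → IsHom A B (φ i)) →
                         Σ ℕ λ i → Σ ℕ λ o → ∀ a → φ i a B.≈ φ (i + suc o) a
  hom-sequence-repeats φ φH = i , o , λ a →
    B.trans (homCode-injective (φH i) (φH j) codes≡ a) (B.reflexive (≡.cong (λ l → φ l a) j≡))
    where
    repeat = pigeonhole (n<1+n (N ^ n)) (λ l → homCode (φ (toℕ l)))
    i = toℕ (proj₁ repeat)
    j = toℕ (proj₁ (proj₂ repeat))
    codes≡ = proj₂ (proj₂ (proj₂ repeat))
    gap = m≤n⇒∃[o]m+o≡n (proj₁ (proj₂ (proj₂ repeat)))
    o = proj₁ gap
    j≡ : j ≡ i + suc o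
    j≡ = ≡.trans (≡.sym (proj₂ gap)) (≡.sym (+-suc i o))

module _ {A : BAO ar c ℓ} {B : BAO ar c′ ℓ′}
         (x : Fin n → BAO.Carrier A) (genX : Generates A x) (finB : IsFinite B)
         {h : BAO.Carrier A → BAO.Carrier A} (hH : IsHom A A h)
         (h-surjective : ∀ a → Σ (BAO.Carrier A) λ a′ → BAO._≈_ A (h a′) a) where
  private
    module A = BAO A
    module B = BAO B

  -- Some φ ∘ hⁱ ≈ φ ∘ hⁱ⁺ᵒ⁺¹, and cancelling the surjection hⁱ gives the factorisation.
  hom-factors-through-surjective-endo :
    ∀ {φ} → IsHom A B φ → Σ ℕ λ o → ∀ a → φ a B.≈ φ (iterate h (h a) o)
  hom-factors-through-surjective-endo {φ} φH = o , λ a →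
    let (a′ , hⁱa′≈a) = iterate-surjective hH h-surjective i a in begin
    φ a                                  ≈⟨ IsHom.cong φH hⁱa′≈a ⟨
    φ (iterate h a′ i)                   ≈⟨ repeats a′ ⟩
    φ (iterate h a′ (i + suc o))         ≡⟨ ≡.cong φ (iterate-+ h a′ i (suc o)) ⟩
    φ (iterate h (h (iterate h a′ i)) o) ≈⟨ IsHom.cong φ∘hᵒ⁺¹ hⁱa′≈a ⟩
    φ (iterate h (h a) o)                ∎
    where
    open SetoidReasoning B.setoid
    sequence = hom-sequence-repeats x genX finB (λ l a → φ (iterate h a l))
                                    (λ l → ∘-isHom (iterate-isHom hH l) φH)
    i = proj₁ sequence
    o = proj₁ (proj₂ sequence)
    repeats = proj₂ (proj₂ sequence)
    φ∘hᵒ⁺¹ = ∘-isHom (∘-isHom hH (iterate-isHom hH o)) φH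

  hom-respects-kernel : ∀ {φ} → IsHom A B φ → ∀ {a b} → h a A.≈ h b → φ a B.≈ φ b
  hom-respects-kernel φH ha≈hb =
    let (o , factors) = hom-factors-through-surjective-endo φH in
    B.trans (factors _)
      (B.trans (IsHom.cong (∘-isHom (iterate-isHom hH o) φH) ha≈hb) (B.sym (factors _)))

separated-by-finite-members : {K : Class ar c ℓ e} (A : BAO ar c ℓ) →
  V (FinPart K) A → (x : Fin n → BAO.Carrier A) → FreelyGenerates K A x →
  ∀ {a b} → (∀ B → FinPart K B → ∀ {φ} → IsHom A B φ → BAO._≈_ B (φ a) (φ b)) →
  BAO._≈_ A a b
separated-by-finite-members {K = K} A A∈V x (genX , extend) {a} {b} separated =
  A.trans (A.sym sx≈a) (A.trans (finEqn-⊨ A s t (A∈V (finEqn s t) holds-in-FinK) x) tx≈b)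
  where
  module A = BAO A
  s = proj₁ (generated-⟦⟧ A x genX a)
  sx≈a = proj₂ (generated-⟦⟧ A x genX a)
  t = proj₁ (generated-⟦⟧ A x genX b)
  tx≈b = proj₂ (generated-⟦⟧ A x genX b)
  holds-in-FinK : Th (FinPart K) (finEqn s t)
  holds-in-FinK B B∈FinK = ⊨-finEqn B s t λ ρ →
    let (φ , φH , φx≈ρ) = extend B (proj₁ B∈FinK) ρ
        value-under-φ : ∀ u {a′} → ⟦ A ⟧ u x A.≈ a′ → ⟦ B ⟧ u ρ B.≈ φ a′
        value-under-φ u ux≈a′ = B.trans (B.sym (⟦⟧-cong B u φx≈ρ))
                                  (B.trans (B.sym (⟦⟧-hom φH u x)) (IsHom.cong φH ux≈a′))
    in B.trans (value-under-φ s sx≈a)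
         (B.trans (separated B B∈FinK φH) (B.sym (value-under-φ t tx≈b)))
    where module B = BAO B

freelyGenerates-along-automorphism : {K : Class ar c ℓ e} {A : BAO ar c ℓ}
  {x y : Fin n → BAO.Carrier A} {h : BAO.Carrier A → BAO.Carrier A} →
  FreelyGenerates K A x → Generates A y → IsHom A A h →
  (∀ {a b} → BAO._≈_ A (h a) (h b) → BAO._≈_ A a b) →
  (g : BAO.Carrier A → BAO.Carrier A) → (∀ a → BAO._≈_ A (h (g a)) a) →
  (∀ k → BAO._≈_ A (h (x k)) (y k)) → FreelyGenerates K A y
freelyGenerates-along-automorphism {A = A} {x} {y} (_ , extend) genY hH h-injective g hg hx≈y =
  genY , λ B B∈K ρ →
    let (φ , φH , φx≈ρ) = extend B B∈K ρ
    in φ ∘ g , ∘-isHom (inverse-isHom hH h-injective g hg) φH ,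
       λ k → BAO.trans B (IsHom.cong φH (gy≈x k)) (φx≈ρ k)
  where
  gy≈x : ∀ k → BAO._≈_ A (g (y k)) (x k)
  gy≈x k = h-injective (BAO.trans A (hg (y k)) (BAO.sym A (hx≈y k)))

mainTheorem4 : {c ℓ e : Level} {m : ℕ} (ar : Fin m → ℕ) (E : Pred (Eqn ar) e) →
    Mod c ℓ E ≐ V (FinPart (Mod c ℓ E)) →
    (A : BAO ar c ℓ) → Mod c ℓ E A →
    (n : ℕ) (x y : Fin n → BAO.Carrier A) →
    InjectiveOn A x → InjectiveOn A y →
    FreelyGenerates (Mod c ℓ E) A x → Generates A y →
    FreelyGenerates (Mod c ℓ E) A y
mainTheorem4 ar E K≐VFinK A A∈K n x y _ _ free@(genX , extend) genY =
  freelyGenerates-along-automorphism free genY hH h-injective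
    (proj₁ ∘ h-surjective) (proj₂ ∘ h-surjective) hx≈y
  where
  h-extension = extend A A∈K y
  h = proj₁ h-extension
  hH = proj₁ (proj₂ h-extension)
  hx≈y = proj₂ (proj₂ h-extension)
  h-surjective = hom-surjective y genY hH (λ k → x k , hx≈y k)
  h-injective : ∀ {a b} → BAO._≈_ A (h a) (h b) → BAO._≈_ A a b
  h-injective ha≈hb = separated-by-finite-members A (proj₁ (K≐VFinK A) A∈K) x free
    λ B B∈FinK φH → hom-respects-kernel x genX (proj₂ B∈FinK) hH h-surjective φH ha≈hb
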